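{- Let $\mathcal{S}$ be an affine subspace of $H_n(\mathbb{F}_2)$. Then $\rho(\mathcal{S}) \geq \nu(G_{\mathcal{S}})$.
   Context: $H_n(\mathbb{F}_2)$ is the space of symmetric $n\times n$ matrices over the two-element field $\mathbb{F}_2$. For a set $\mathcal{S}$ of matrices, $\rho(\mathcal{S})=\max\{\mathrm{rk}(A): A\in\mathcal{S}\}$. Let $[n]=\{1,\dots,n\}$ and order $\{(i,j)\in[n]^2: i\le j\}$ colexicographically: $(i,j)\prec(i',j')$ iff $j<j'$, or $j=j'$ and $i<i'$. For a nonzero symmetric matrix $B$, let $q(B)$ be the $\prec$-maximal pair $(i,j)$ with $i\le j$ and $B(i,j)\neq 0$, and set $\tilde q(B)=\{i,j\}$ (a set of size 1 or 2). Writing $\mathcal{S}=A+\mathcal{B}$ with $\mathcal{B}$ a linear subspace of $H_n(\mathbb{F}_2)$, let $G_{\mathcal{S}}=\{\tilde q(B): 0\neq B\in\mathcal{B}\}$, a graph with loops on $[n]$. A matching is a set of pairwise disjoint edges (edges being subsets of $[n]$ of size 1 or 2); $\nu(G)$ is the maximum number of edges in a matching $M\subset G$. -}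

module Defs where

open import Data.Bool using (Bool; true; false; _xor_; _∧_)
open import Data.Nat using (ℕ; zero; suc)
open import Data.Fin using (Fin; zero; suc; _<_; _≤_)
open import Data.Product using (Σ; _×_; _,_; ∃; ∃-syntax)
open import Data.Sum using (_⊎_)
open import Relation.Binary.PropositionalEquality using (_≡_; _≢_)
open import Relation.Nullary using (¬_)

-- Vectors over 𝔽₂ = Bool (addition = xor, multiplication = ∧)
Vec₂ : ℕ → Set
Vec₂ n = Fin n → Bool

zeroV : ∀ {n} → Vec₂ n
zeroV _ = false

Mat : ℕ → Set
Mat n = Fin n → Fin n → Bool

_+M_ : ∀ {n} → Mat n → Mat n → Mat n
(A +M B) i j = A i j xor B i j

zeroM : ∀ {n} → Mat n
zeroM _ _ = false

Symmetric : ∀ {n} → Mat n → Set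
Symmetric A = ∀ i j → A i j ≡ A j i

lincomb : ∀ {n} (k : ℕ) → (Fin k → Bool) → (Fin k → Vec₂ n) → Vec₂ n
lincomb zero    c v x = false
lincomb (suc k) c v x = (c zero ∧ v zero x) xor lincomb k (λ t → c (suc t)) (λ t → v (suc t)) x

LinIndep : ∀ {n} (k : ℕ) → (Fin k → Vec₂ n) → Set
LinIndep k v = ∀ (c : Fin k → Bool) → (∀ x → lincomb k c v x ≡ false) → ∀ t → c t ≡ false

-- rk(A) ≥ k : A has k linearly independent rows (rank = row rank)
RankAtLeast : ∀ {n} → Mat n → ℕ → Set
RankAtLeast {n} A k = Σ (Fin k → Fin n) λ r → LinIndep k (λ t → A (r t))

record IsSymSubspace {n : ℕ} (𝓑 : Mat n → Set) : Set where
  field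
    sym   : ∀ B → 𝓑 B → Symmetric B
    has0  : 𝓑 zeroM
    add   : ∀ B C → 𝓑 B → 𝓑 C → 𝓑 (B +M C)

_≺_ : ∀ {n} → Fin n × Fin n → Fin n × Fin n → Set
(i , j) ≺ (i' , j') = (j < j') ⊎ (j ≡ j' × i < i')

IsQ : ∀ {n} → Mat n → Fin n × Fin n → Set
IsQ B (i , j) = (i ≤ j) × (B i j ≡ true) ×
  (∀ i' j' → i' ≤ j' → B i' j' ≡ true → ¬ ((i , j) ≺ (i' , j')))

-- {i,j} ∈ G_S (edge represented by the pair (i,j), i ≤ j), where S = A + 𝓑
InG : ∀ {n} → (Mat n → Set) → Fin n × Fin n → Set
InG 𝓑 e = ∃[ B ] (𝓑 B × B ≢ zeroM × IsQ B e)

Disjoint : ∀ {n} → Fin n × Fin n → Fin n × Fin n → Set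
Disjoint (i , j) (i' , j') = i ≢ i' × i ≢ j' × j ≢ i' × j ≢ j'

IsMatching : ∀ {n} → (Mat n → Set) → (k : ℕ) → (Fin k → Fin n × Fin n) → Set
IsMatching 𝓑 k M = (∀ t → InG 𝓑 (M t)) × (∀ s t → s ≢ t → Disjoint (M s) (M t))

-- Let the matching consist of the edges {aₜ, bₜ} (aₜ ≤ bₜ), with Bₜ ∈ 𝓑 and q(Bₜ) = (aₜ, bₜ).
-- Maximality of q(Bₜ) makes every row of Bₜ with index > bₜ vanish, and row bₜ of Bₜ has
-- pivot aₜ, so the rows bₜ of the Bₜ form a triangular, hence independent, family.
-- Replace these rows one at a time, from the largest bₜ downwards, by row bₜ of
-- A + Σ cₜ Bₜ.  The rows replaced earlier do not depend on cₛ (their index exceeds bₛ),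
-- while the new row bₛ is y or y + (row bₛ of Bₛ) according to cₛ; by the exchange
-- property over 𝔽₂ one of the two choices keeps the family independent.
module Submission where

open import Defs
open import Data.Nat using (ℕ)
open import Data.Fin using (Fin)
open import Data.Product using (_×_; ∃-syntax)

open import Algebra.Bundles using (CommutativeRing)
open import Data.Bool as Bool using (Bool; true; false; _xor_; _∧_; if_then_else_)
open import Data.Bool.Properties
  using (xor-assoc; xor-comm; xor-identityʳ; xor-same; ∧-identityʳ; ∧-zeroʳ; ∧-distribʳ-xor;
         ¬-not; xor-∧-commutativeRing)
open import Algebra.Properties.CommutativeSemigroup
  (CommutativeRing.+-commutativeSemigroup xor-∧-commutativeRing) using (interchange)
import Data.Nat as ℕ
import Data.Nat.Properties as ℕ
open import Data.Nat using (zero; suc)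
open import Data.Fin using (zero; suc; toℕ; _<_; _≤_; _>_; _≟_)
open import Data.Fin.Properties using (any?; all?; <-cmp; toℕ<n; toℕ-injective)
open import Data.Fin.Induction using (>-wellFounded)
open import Data.Fin.Subset.Properties using (anySubset?)
open import Data.Vec using (lookup; tabulate)
open import Data.Vec.Properties using (lookup∘tabulate)
open import Data.Vec.Functional using (updateAt; zipWith)
open import Data.Vec.Functional.Properties
  using (updateAt-updates; updateAt-minimal; updateAt-id-local)
open import Data.Product using (_,_; proj₁; proj₂)
open import Data.Sum using (inj₁; inj₂)
open import Function using (_∘_; const)
import Induction.WellFounded as WF
import Relation.Binary.Construct.On as On
open import Relation.Binary.Definitions using (tri<; tri≈; tri>)
open import Relation.Binary.PropositionalEquality
  using (_≡_; _≢_; refl; sym; trans; cong; cong₂; cong-app; subst; _≗_; module ≡-Reasoning)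
open import Relation.Nullary using (¬_; yes; no; contradiction; does; _×-dec_)
open import Relation.Nullary.Decidable using (Dec; map′; dec-true; dec-false)

open ≡-Reasoning

infixl 6 _⊕_
infixr 7 _·_

_⊕_ : ∀ {n} → Vec₂ n → Vec₂ n → Vec₂ n
_⊕_ = zipWith _xor_

_·_ : ∀ {n} → Bool → Vec₂ n → Vec₂ n
(β · w) x = β ∧ w x

xor≡false⇒≡ : ∀ {a b} → a xor b ≡ false → a ≡ b
xor≡false⇒≡ {false} {false} _ = refl
xor≡false⇒≡ {true}  {true}  _ = refl

≗-atAndOff : ∀ {k} {A : Set} {f g : Fin k → A} s →
  f s ≡ g s → (∀ t → t ≢ s → f t ≡ g t) → f ≗ g
≗-atAndOff s at off t with t ≟ s
... | yes refl = at
... | no t≢s   = off t t≢s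

≢-preserving⇒injective : ∀ {k} {A : Set} (f : Fin k → A) →
  (∀ s t → s ≢ t → f s ≢ f t) → ∀ {s t} → f s ≡ f t → s ≡ t
≢-preserving⇒injective f preserves {s} {t} fs≡ft with s ≟ t
... | yes s≡t = s≡t
... | no s≢t  = contradiction fs≡ft (preserves s t s≢t)

module _ {n : ℕ} where

  lincomb-cong : ∀ k {c c' : Fin k → Bool} {v w : Fin k → Vec₂ n} {x} →
    (∀ t → c t ∧ v t x ≡ c' t ∧ w t x) → lincomb k c v x ≡ lincomb k c' w x
  lincomb-cong zero    terms = refl
  lincomb-cong (suc k) terms = cong₂ _xor_ (terms zero) (lincomb-cong k (terms ∘ suc))

  lincomb-zero : ∀ k {c : Fin k → Bool} {v : Fin k → Vec₂ n} {x} →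
    (∀ t → c t ∧ v t x ≡ false) → lincomb k c v x ≡ false
  lincomb-zero zero    terms = refl
  lincomb-zero (suc k) terms = cong₂ _xor_ (terms zero) (lincomb-zero k (terms ∘ suc))

  lincomb-xor : ∀ k (c c' : Fin k → Bool) (v : Fin k → Vec₂ n) x →
    lincomb k (c ⊕ c') v x ≡ lincomb k c v x xor lincomb k c' v x
  lincomb-xor zero    c c' v x = refl
  lincomb-xor (suc k) c c' v x = begin
    ((c zero xor c' zero) ∧ v zero x) xor lincomb k (c ∘ suc ⊕ c' ∘ suc) (v ∘ suc) x
      ≡⟨ cong₂ _xor_ (∧-distribʳ-xor (v zero x) (c zero) (c' zero))
                     (lincomb-xor k (c ∘ suc) (c' ∘ suc) (v ∘ suc) x) ⟩
    ((c zero ∧ v zero x) xor (c' zero ∧ v zero x)) xor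
      (lincomb k (c ∘ suc) (v ∘ suc) x xor lincomb k (c' ∘ suc) (v ∘ suc) x)
      ≡⟨ interchange (c zero ∧ v zero x) (c' zero ∧ v zero x) _ _ ⟩
    lincomb (suc k) c v x xor lincomb (suc k) c' v x ∎

  lincomb-updateAt : ∀ k (c : Fin k → Bool) (v : Fin k → Vec₂ n) s β x →
    lincomb k (updateAt c s (const β)) v x ≡
    lincomb k (updateAt c s (const false)) v x xor (β ∧ v s x)
  lincomb-updateAt (suc k) c v zero    β x = xor-comm (β ∧ v zero x) _
  lincomb-updateAt (suc k) c v (suc s) β x =
    trans (cong ((c zero ∧ v zero x) xor_) (lincomb-updateAt k (c ∘ suc) (v ∘ suc) s β x))
          (sym (xor-assoc (c zero ∧ v zero x) _ _))

  lincomb-split : ∀ k (c : Fin k → Bool) (v : Fin k → Vec₂ n) s x →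
    lincomb k c v x ≡ lincomb k (updateAt c s (const false)) v x xor (c s ∧ v s x)
  lincomb-split k c v s x =
    trans (lincomb-cong k (λ t → cong (_∧ v t x) (sym (updateAt-id-local s c refl t))))
          (lincomb-updateAt k c v s (c s) x)

  lincomb-updateAt-irrelevant : ∀ k (c : Fin k → Bool) (v : Fin k → Vec₂ n) s f x →
    v s x ≡ false → lincomb k (updateAt c s f) v x ≡ lincomb k c v x
  lincomb-updateAt-irrelevant k c v s f x vs≡0 = lincomb-cong k (≗-atAndOff s at off)
    where
    at : updateAt c s f s ∧ v s x ≡ c s ∧ v s x
    at rewrite vs≡0 = trans (∧-zeroʳ _) (sym (∧-zeroʳ _))
    off : ∀ t → t ≢ s → updateAt c s f t ∧ v t x ≡ c t ∧ v t x
    off t t≢s = cong (_∧ v t x) (updateAt-minimal t s c t≢s)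

  LinIndep-cong : ∀ k {v w : Fin k → Vec₂ n} → (∀ t x → v t x ≡ w t x) →
    LinIndep k v → LinIndep k w
  LinIndep-cong k v≗w v-indep c rel =
    v-indep c (λ x → trans (lincomb-cong k (λ t → cong (c t ∧_) (v≗w t x))) (rel x))

  LinIndep-triangular : ∀ k {v : Fin k → Vec₂ n} (p : Fin k → Fin n) →
    (∀ {s t} → p s ≡ p t → s ≡ t) →
    (∀ t → v t (p t) ≡ true) →
    (∀ s t → p s < p t → v s (p t) ≡ false) →
    LinIndep k v
  LinIndep-triangular k {v} p p-injective pivot lower c rel =
    WF.All.wfRec (On.wellFounded p >-wellFounded) _ (λ t → c t ≡ false) vanishes
    where
    vanishes : ∀ t → (∀ {s} → p s > p t → c s ≡ false) → c t ≡ false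
    vanishes t higher = begin
      c t                                                  ≡⟨ sym (∧-identityʳ (c t)) ⟩
      c t ∧ true                                           ≡⟨ cong (c t ∧_) (sym (pivot t)) ⟩
      false xor (c t ∧ v t (p t))                          ≡⟨ cong (_xor _) (sym others) ⟩
      lincomb k (updateAt c t (const false)) v (p t) xor (c t ∧ v t (p t))
                                                           ≡⟨ sym (lincomb-split k c v t (p t)) ⟩
      lincomb k c v (p t)                                  ≡⟨ rel (p t) ⟩
      false                                                ∎
      where
      term : ∀ s → s ≢ t → c s ∧ v s (p t) ≡ false
      term s s≢t with <-cmp (p s) (p t)
      ... | tri< ps<pt _ _ = trans (cong (c s ∧_) (lower s t ps<pt)) (∧-zeroʳ (c s))
      ... | tri≈ _ ps≡pt _ = contradiction (p-injective ps≡pt) s≢t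
      ... | tri> _ _ ps>pt = cong (_∧ v s (p t)) (higher ps>pt)

      others : lincomb k (updateAt c t (const false)) v (p t) ≡ false
      others = lincomb-zero k
        (≗-atAndOff t (cong (_∧ v t (p t)) (updateAt-updates t c)) λ s s≢t →
          trans (cong (_∧ v s (p t)) (updateAt-minimal s t c s≢t)) (term s s≢t))

  InSpanWithout : ∀ k → (Fin k → Vec₂ n) → Fin k → Vec₂ n → Set
  InSpanWithout k v s z = ∃[ c ] (c s ≡ false × (∀ x → lincomb k c v x ≡ z x))

  InSpanWithout? : ∀ k v s z → Dec (InSpanWithout k v s z)
  InSpanWithout? k v s z = map′ fromSubset toSubset (anySubset? λ p →
      (lookup p s Bool.≟ false) ×-dec all? (λ x → lincomb k (lookup p) v x Bool.≟ z x))
    where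
    fromSubset : ∃[ p ] (lookup p s ≡ false × (∀ x → lincomb k (lookup p) v x ≡ z x)) →
                 InSpanWithout k v s z
    fromSubset (p , spans) = lookup p , spans
    toSubset : InSpanWithout k v s z →
               ∃[ p ] (lookup p s ≡ false × (∀ x → lincomb k (lookup p) v x ≡ z x))
    toSubset (c , cs≡0 , spans) =
      tabulate c , trans (lookup∘tabulate c s) cs≡0 ,
      λ x → trans (lincomb-cong k (λ t → cong (_∧ v t x) (lookup∘tabulate c t))) (spans x)

  InSpanWithout-resp : ∀ {k v s} {z z' : Vec₂ n} → (∀ x → z x ≡ z' x) →
    InSpanWithout k v s z → InSpanWithout k v s z'
  InSpanWithout-resp z≗z' (c , cs≡0 , spans) = c , cs≡0 , λ x → trans (spans x) (z≗z' x)

  InSpanWithout-⊕ : ∀ {k v s} {y z : Vec₂ n} →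
    InSpanWithout k v s y → InSpanWithout k v s z → InSpanWithout k v s (y ⊕ z)
  InSpanWithout-⊕ {k} {v} (c , cs≡0 , spans) (c' , c's≡0 , spans') =
    c ⊕ c' , cong₂ _xor_ cs≡0 c's≡0 ,
    λ x → trans (lincomb-xor k c c' v x) (cong₂ _xor_ (spans x) (spans' x))

  LinIndep⇒∉InSpanWithout : ∀ {k v} s → LinIndep k v → ¬ InSpanWithout k v s (v s)
  LinIndep⇒∉InSpanWithout {k} {v} s v-indep (c , cs≡0 , spans) =
    contradiction (trans (sym (updateAt-updates s c)) (v-indep _ relation s)) λ ()
    where
    relation : ∀ x → lincomb k (updateAt c s (const true)) v x ≡ false
    relation x = begin
      lincomb k (updateAt c s (const true)) v x
        ≡⟨ lincomb-updateAt k c v s true x ⟩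
      lincomb k (updateAt c s (const false)) v x xor v s x
        ≡⟨ cong (_xor v s x) (lincomb-cong k (λ t →
             cong (_∧ v t x) (updateAt-id-local s c (sym cs≡0) t))) ⟩
      lincomb k c v x xor v s x
        ≡⟨ cong (_xor v s x) (spans x) ⟩
      v s x xor v s x
        ≡⟨ xor-same (v s x) ⟩
      false ∎

  LinIndep-updateAt : ∀ {k v s} {f : Vec₂ n → Vec₂ n} → LinIndep k v →
    ¬ InSpanWithout k v s (f (v s)) → LinIndep k (updateAt v s f)
  LinIndep-updateAt {k} {v} {s} {f} v-indep fvs∉ c rel t =
    trans (sym (updateAt-id-local s c (sym cs≡0) t)) (v-indep c₀ c₀-relation t)
    where
    c₀ : Fin k → Bool
    c₀ = updateAt c s (const false)

    c₀s≡0 : c₀ s ≡ false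
    c₀s≡0 = updateAt-updates s c

    c₀-spans : ∀ x → lincomb k c₀ v x ≡ c s ∧ f (v s) x
    c₀-spans x = xor≡false⇒≡ (begin
      lincomb k c₀ v x xor (c s ∧ f (v s) x)
        ≡⟨ cong₂ _xor_ (lincomb-cong k (≗-atAndOff s
                          (trans (cong (_∧ v s x) c₀s≡0)
                                 (sym (cong (_∧ updateAt v s f s x) c₀s≡0)))
                          λ t t≢s → cong (c₀ t ∧_) (sym (cong-app (updateAt-minimal t s v t≢s) x))))
                       (cong (λ w → c s ∧ w x) (sym (updateAt-updates s v))) ⟩
      lincomb k c₀ (updateAt v s f) x xor (c s ∧ updateAt v s f s x)
        ≡⟨ sym (lincomb-split k c (updateAt v s f) s x) ⟩
      lincomb k c (updateAt v s f) x
        ≡⟨ rel x ⟩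
      false ∎)

    cs≡0 : c s ≡ false
    cs≡0 = ¬-not λ cs≡1 → fvs∉
      (c₀ , c₀s≡0 , λ x → trans (c₀-spans x) (cong (_∧ f (v s) x) cs≡1))

    c₀-relation : ∀ x → lincomb k c₀ v x ≡ false
    c₀-relation x = trans (c₀-spans x) (cong (_∧ f (v s) x) cs≡0)

  LinIndep-exchange : ∀ {k v} → LinIndep k v → ∀ s (y : Vec₂ n) →
    ∃[ β ] LinIndep k (updateAt v s (λ w → y ⊕ β · w))
  LinIndep-exchange {k} {v} v-indep s y with InSpanWithout? k v s y
  ... | no y∉ = false , LinIndep-updateAt v-indep
          (y∉ ∘ InSpanWithout-resp (λ x → xor-identityʳ (y x)))
  ... | yes y∈ = true , LinIndep-updateAt v-indep λ y+vs∈ →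
          LinIndep⇒∉InSpanWithout s v-indep (InSpanWithout-resp cancel (InSpanWithout-⊕ y∈ y+vs∈))
    where
    cancel : ∀ x → y x xor (y x xor v s x) ≡ v s x
    cancel x = trans (sym (xor-assoc (y x) (y x) _)) (cong (_xor v s x) (xor-same (y x)))

  IsQ-pivot : ∀ {B : Mat n} {i j} → Symmetric B → IsQ B (i , j) → B j i ≡ true
  IsQ-pivot B-sym (_ , Bij≡1 , _) = trans (B-sym _ _) Bij≡1

  IsQ-maximal : ∀ {B : Mat n} {i j x y} → IsQ B (i , j) → x ≤ y → (i , j) ≺ (x , y) →
    B x y ≡ false
  IsQ-maximal (_ , _ , maximal) x≤y ≺xy = ¬-not λ Bxy≡1 → maximal _ _ x≤y Bxy≡1 ≺xy

  IsQ-laterRow-vanishes : ∀ {B : Mat n} {i j r} → Symmetric B → IsQ B (i , j) → j < r →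
    ∀ x → B r x ≡ false
  IsQ-laterRow-vanishes {r = r} B-sym q j<r x with toℕ r ℕ.≤? toℕ x
  ... | yes r≤x = IsQ-maximal q r≤x (inj₁ (ℕ.<-≤-trans j<r r≤x))
  ... | no  r≰x = trans (B-sym r x) (IsQ-maximal q (ℕ.<⇒≤ (ℕ.≰⇒> r≰x)) (inj₁ j<r))

  IsQ-pivotRow-vanishes : ∀ {B : Mat n} {i j x} → Symmetric B → IsQ B (i , j) → i < x →
    B j x ≡ false
  IsQ-pivotRow-vanishes {j = j} {x} B-sym q i<x with toℕ x ℕ.≤? toℕ j
  ... | yes x≤j = trans (B-sym j x) (IsQ-maximal q x≤j (inj₂ (refl , i<x)))
  ... | no  x≰j = IsQ-maximal q (ℕ.<⇒≤ (ℕ.≰⇒> x≰j)) (inj₁ (ℕ.≰⇒> x≰j))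

  -- 𝓑 need not respect pointwise equality, so Σ cₜ Bₜ is built from _+M_ and zeroM themselves.
  combM : ∀ k → (Fin k → Bool) → (Fin k → Mat n) → Mat n
  combM zero    c Bs = zeroM
  combM (suc k) c Bs = (if c zero then Bs zero else zeroM) +M combM k (c ∘ suc) (Bs ∘ suc)

  combM-∈ : ∀ {𝓑} → IsSymSubspace 𝓑 → ∀ k c Bs → (∀ t → 𝓑 (Bs t)) → 𝓑 (combM k c Bs)
  combM-∈ 𝓑-subspace zero    c Bs Bs∈𝓑 = IsSymSubspace.has0 𝓑-subspace
  combM-∈ {𝓑} 𝓑-subspace (suc k) c Bs Bs∈𝓑 =
    IsSymSubspace.add 𝓑-subspace _ _ (head∈𝓑 (c zero)) (combM-∈ 𝓑-subspace k _ _ (Bs∈𝓑 ∘ suc))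
    where
    head∈𝓑 : ∀ β → 𝓑 (if β then Bs zero else zeroM)
    head∈𝓑 true  = Bs∈𝓑 zero
    head∈𝓑 false = IsSymSubspace.has0 𝓑-subspace

  combM-row : ∀ k c Bs r x → combM k c Bs r x ≡ lincomb k c (λ t → Bs t r) x
  combM-row zero    c Bs r x = refl
  combM-row (suc k) c Bs r x =
    cong₂ _xor_ (head-entry (c zero)) (combM-row k (c ∘ suc) (Bs ∘ suc) r x)
    where
    head-entry : ∀ β → (if β then Bs zero else zeroM) r x ≡ β ∧ Bs zero r x
    head-entry true  = refl
    head-entry false = refl

module MatchingRows {n : ℕ} (A : Mat n) {𝓑 : Mat n → Set} (𝓑-subspace : IsSymSubspace 𝓑)
                    {k : ℕ} {M : Fin k → Fin n × Fin n} (M-matching : IsMatching 𝓑 k M) where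

  a b : Fin k → Fin n
  a t = proj₁ (M t)
  b t = proj₂ (M t)

  B : Fin k → Mat n
  B t = proj₁ (proj₁ M-matching t)

  B∈𝓑 : ∀ t → 𝓑 (B t)
  B∈𝓑 t = proj₁ (proj₂ (proj₁ M-matching t))

  B-sym : ∀ t → Symmetric (B t)
  B-sym t = IsSymSubspace.sym 𝓑-subspace _ (B∈𝓑 t)

  B-q : ∀ t → IsQ (B t) (a t , b t)
  B-q t = proj₂ (proj₂ (proj₂ (proj₁ M-matching t)))

  a-injective : ∀ {s t} → a s ≡ a t → s ≡ t
  a-injective = ≢-preserving⇒injective a λ s t s≢t → proj₁ (proj₂ M-matching s t s≢t)

  b-injective : ∀ {s t} → b s ≡ b t → s ≡ t
  b-injective = ≢-preserving⇒injective b λ s t s≢t →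
    proj₂ (proj₂ (proj₂ (proj₂ M-matching s t s≢t)))

  pivotRow : Fin k → Vec₂ n
  pivotRow t = B t (b t)

  pivotRows-independent : LinIndep k pivotRow
  pivotRows-independent = LinIndep-triangular k a a-injective
    (λ t → IsQ-pivot (B-sym t) (B-q t))
    (λ s t as<at → IsQ-pivotRow-vanishes (B-sym s) (B-q s) as<at)

  C : (Fin k → Bool) → Mat n
  C c = A +M combM k c B

  C-row : ∀ c r x → C c r x ≡ A r x xor lincomb k c (λ t → B t r) x
  C-row c r x = cong (A r x xor_) (combM-row k c B r x)

  C-row-updateAt : ∀ c s β r x →
    C (updateAt c s (const β)) r x ≡ C (updateAt c s (const false)) r x xor (β ∧ B s r x)
  C-row-updateAt c s β r x = begin
    C (updateAt c s (const β)) r x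
      ≡⟨ C-row _ r x ⟩
    A r x xor lincomb k (updateAt c s (const β)) (λ t → B t r) x
      ≡⟨ cong (A r x xor_) (lincomb-updateAt k c (λ t → B t r) s β x) ⟩
    A r x xor (lincomb k (updateAt c s (const false)) (λ t → B t r) x xor (β ∧ B s r x))
      ≡⟨ sym (xor-assoc (A r x) _ _) ⟩
    (A r x xor lincomb k (updateAt c s (const false)) (λ t → B t r) x) xor (β ∧ B s r x)
      ≡⟨ cong (_xor (β ∧ B s r x)) (sym (C-row _ r x)) ⟩
    C (updateAt c s (const false)) r x xor (β ∧ B s r x) ∎

  C-laterRow-updateAt : ∀ c s f r x → b s < r → C (updateAt c s f) r x ≡ C c r x
  C-laterRow-updateAt c s f r x bs<r = begin
    C (updateAt c s f) r x                               ≡⟨ C-row _ r x ⟩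
    A r x xor lincomb k (updateAt c s f) (λ t → B t r) x ≡⟨ cong (A r x xor_)
      (lincomb-updateAt-irrelevant k c (λ t → B t r) s f x
        (IsQ-laterRow-vanishes (B-sym s) (B-q s) bs<r x)) ⟩
    A r x xor lincomb k c (λ t → B t r) x                ≡⟨ sym (C-row c r x) ⟩
    C c r x                                              ∎

  mixedRows : ℕ → (Fin k → Bool) → Fin k → Vec₂ n
  mixedRows m c t = if does (m ℕ.≤? toℕ (b t)) then C c (b t) else pivotRow t

  mixedRows-switched : ∀ {m} c t → m ℕ.≤ toℕ (b t) → mixedRows m c t ≡ C c (b t)
  mixedRows-switched c t m≤bt = cong (λ δ → if δ then _ else _) (dec-true (_ ℕ.≤? _) m≤bt)

  mixedRows-pivot : ∀ {m} c t → toℕ (b t) ℕ.< m → mixedRows m c t ≡ pivotRow t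
  mixedRows-pivot c t bt<m = cong (λ δ → if δ then _ else _) (dec-false (_ ℕ.≤? _) (ℕ.<⇒≱ bt<m))

  mixedRows-suc : ∀ m c t → toℕ (b t) ≢ m → mixedRows m c t ≡ mixedRows (suc m) c t
  mixedRows-suc m c t bt≢m with ℕ.<-cmp m (toℕ (b t))
  ... | tri< m<bt _ _ =
    trans (mixedRows-switched c t (ℕ.<⇒≤ m<bt)) (sym (mixedRows-switched c t m<bt))
  ... | tri≈ _ m≡bt _ = contradiction (sym m≡bt) bt≢m
  ... | tri> _ _ bt<m =
    trans (mixedRows-pivot c t bt<m) (sym (mixedRows-pivot c t (ℕ.m<n⇒m<1+n bt<m)))

  mixedRows-updateAt : ∀ m c s f t x → toℕ (b s) ≡ m →
    mixedRows (suc m) (updateAt c s f) t x ≡ mixedRows (suc m) c t x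
  mixedRows-updateAt m c s f t x bs≡m with suc m ℕ.≤? toℕ (b t)
  ... | yes m<bt = begin
    mixedRows (suc m) (updateAt c s f) t x ≡⟨ cong-app (mixedRows-switched _ t m<bt) x ⟩
    C (updateAt c s f) (b t) x             ≡⟨ C-laterRow-updateAt c s f (b t) x
                                                (subst (ℕ._< toℕ (b t)) (sym bs≡m) m<bt) ⟩
    C c (b t) x                            ≡⟨ cong-app (mixedRows-switched c t m<bt) x ⟨
    mixedRows (suc m) c t x                ∎
  ... | no m≮bt = trans (cong-app (mixedRows-pivot _ t (ℕ.≰⇒> m≮bt)) x)
                        (sym (cong-app (mixedRows-pivot c t (ℕ.≰⇒> m≮bt)) x))

  switchRow : ∀ m c s → toℕ (b s) ≡ m → LinIndep k (mixedRows (suc m) c) →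
    ∃[ c' ] LinIndep k (mixedRows m c')
  switchRow m c s bs≡m indep with LinIndep-exchange indep s (C (updateAt c s (const false)) (b s))
  ... | β , indep' = updateAt c s (const β) , LinIndep-cong k rows indep'
    where
    v : Fin k → Vec₂ n
    v = mixedRows (suc m) c
    y : Vec₂ n
    y = C (updateAt c s (const false)) (b s)
    c' : Fin k → Bool
    c' = updateAt c s (const β)

    at : ∀ x → updateAt v s (λ w → y ⊕ β · w) s x ≡ mixedRows m c' s x
    at x = begin
      updateAt v s (λ w → y ⊕ β · w) s x ≡⟨ cong-app (updateAt-updates s v) x ⟩
      y x xor (β ∧ v s x)                 ≡⟨ cong (λ w → y x xor (β ∧ w x))
        (mixedRows-pivot c s (subst (ℕ._< suc m) (sym bs≡m) (ℕ.n<1+n m))) ⟩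
      y x xor (β ∧ B s (b s) x)           ≡⟨ C-row-updateAt c s β (b s) x ⟨
      C c' (b s) x                        ≡⟨ cong-app
        (mixedRows-switched c' s (ℕ.≤-reflexive (sym bs≡m))) x ⟨
      mixedRows m c' s x                  ∎

    off : ∀ x t → t ≢ s → updateAt v s (λ w → y ⊕ β · w) t x ≡ mixedRows m c' t x
    off x t t≢s = begin
      updateAt v s (λ w → y ⊕ β · w) t x ≡⟨ cong-app (updateAt-minimal t s v t≢s) x ⟩
      v t x                               ≡⟨ mixedRows-updateAt m c s (const β) t x bs≡m ⟨
      mixedRows (suc m) c' t x            ≡⟨ cong-app (mixedRows-suc m c' t
        λ bt≡m → t≢s (b-injective (toℕ-injective (trans bt≡m (sym bs≡m))))) x ⟨
      mixedRows m c' t x                  ∎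

    rows : ∀ t x → updateAt v s (λ w → y ⊕ β · w) t x ≡ mixedRows m c' t x
    rows t x = ≗-atAndOff s (at x) (off x) t

  switchRows : ∀ j m → n ℕ.≤ j ℕ.+ m → ∃[ c ] LinIndep k (mixedRows m c)
  switchRows zero m n≤m = const false , LinIndep-cong k
    (λ t x → sym (cong-app (mixedRows-pivot _ t (ℕ.<-≤-trans (toℕ<n (b t)) n≤m)) x))
    pivotRows-independent
  switchRows (suc j) m n≤1+j+m
    with switchRows j (suc m) (subst (n ℕ.≤_) (sym (ℕ.+-suc j m)) n≤1+j+m)
       | any? (λ s → toℕ (b s) ℕ.≟ m)
  ... | c , indep | yes (s , bs≡m) = switchRow m c s bs≡m indep
  ... | c , indep | no  ∄s = c , LinIndep-cong k
    (λ t x → sym (cong-app (mixedRows-suc m c t λ bt≡m → ∄s (t , bt≡m)) x)) indep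

corollary1p3 : (n : ℕ) (A : Mat n) → Symmetric A →
    (𝓑 : Mat n → Set) → IsSymSubspace 𝓑 →
    (k : ℕ) (M : Fin k → Fin n × Fin n) → IsMatching 𝓑 k M →
    ∃[ B ] (𝓑 B × RankAtLeast (A +M B) k)
corollary1p3 n A _ 𝓑 𝓑-subspace k M M-matching =
  let open MatchingRows A 𝓑-subspace M-matching
      c , indep = switchRows n 0 (ℕ.≤-reflexive (sym (ℕ.+-identityʳ n)))
  in combM k c B , combM-∈ 𝓑-subspace k c B B∈𝓑 ,
     b , LinIndep-cong k (λ t → cong-app (mixedRows-switched c t ℕ.z≤n)) indep
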